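{- For all $n\ge0$, the lattice $L_n$ of arithmetic progressions in $[n]$ is comodernistic.
   Context: $L_n$ is the set of all subsets of $[n]=\{1,\ldots,n\}$ that are arithmetic progressions $\{a,a+r,\ldots,a+(k-1)r\}$ ($a$, $r\ge1$, $k\ge0$ integers; including $\emptyset$, singletons and $2$-element subsets), ordered by inclusion; $L_0=\{\emptyset\}$. An element $m$ of a lattice $L$ is left-modular in $L$ if for all $x<y$ in $L$, $(x\vee m)\wedge y=x\vee(m\wedge y)$. A lattice is comodernistic if every interval $[x,y]$ of it has a coatom (element covered by $y$ in $[x,y]$) which is left-modular in the lattice $[x,y]$. -}

module Defs where

open import Data.Nat using (ℕ; zero; suc; _+_; _*_; _≤_; _<_)
open import Data.Fin using (Fin; toℕ)
open import Data.Fin.Subset using (Subset; _∈_; _⊆_)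
open import Data.Product using (Σ; ∃; _×_; _,_; proj₁)
open import Data.Sum using (_⊎_)
open import Relation.Binary.PropositionalEquality using (_≡_)
open import Relation.Nullary using (¬_)
open import Function.Bundles using (_⇔_)

-- A subset of [n] = {1,…,n} is encoded as a Subset n; the element
-- x : Fin n represents the number toℕ x + 1.

IsAP : (n : ℕ) → Subset n → Set
IsAP n S =
  Σ ℕ λ a → Σ ℕ λ r → Σ ℕ λ k →
    (1 ≤ a) × (1 ≤ r)
    × (∀ i → i < k → a + i * r ≤ n)
    × (∀ (x : Fin n) → (x ∈ S) ⇔ (Σ ℕ λ i → (i < k) × (suc (toℕ x) ≡ a + i * r)))

L : ℕ → Set
L n = Σ (Subset n) (IsAP n)

_≤L_ : ∀ {n} → L n → L n → Set
x ≤L y = proj₁ x ⊆ proj₁ y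

_≈L_ : ∀ {n} → L n → L n → Set
x ≈L y = proj₁ x ≡ proj₁ y

_<L_ : ∀ {n} → L n → L n → Set
x <L y = (x ≤L y) × ¬ (x ≈L y)

In : ∀ {n} → L n → L n → L n → Set
In u v z = (u ≤L z) × (z ≤L v)

IsJoinIn : ∀ {n} → (u v x y j : L n) → Set
IsJoinIn u v x y j =
  In u v j × (x ≤L j) × (y ≤L j)
  × (∀ z → In u v z → x ≤L z → y ≤L z → j ≤L z)

IsMeetIn : ∀ {n} → (u v x y m : L n) → Set
IsMeetIn u v x y m =
  In u v m × (m ≤L x) × (m ≤L y)
  × (∀ z → In u v z → z ≤L x → z ≤L y → z ≤L m)

IsLatticeL : ℕ → Set
IsLatticeL n =
  ∀ (x y : L n) →
    (Σ (L n) λ j → (x ≤L j) × (y ≤L j) × (∀ z → x ≤L z → y ≤L z → j ≤L z))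
    × (Σ (L n) λ m → (m ≤L x) × (m ≤L y) × (∀ z → z ≤L x → z ≤L y → z ≤L m))

-- m is left-modular in the lattice [u,v]:
-- for all x < y in [u,v], (x ∨ m) ∧ y = x ∨ (m ∧ y),
-- joins/meets taken in [u,v] (stated for any witnesses of them).
LeftModularIn : ∀ {n} → (u v m : L n) → Set
LeftModularIn u v m =
  ∀ x y → In u v x → In u v y → x <L y →
  ∀ j k l p →
    IsJoinIn u v x m j → IsMeetIn u v j y k →
    IsMeetIn u v m y l → IsJoinIn u v x l p →
    k ≈L p

IsCoatomIn : ∀ {n} → (u v m : L n) → Set
IsCoatomIn u v m =
  In u v m × (m <L v) × (∀ z → In u v z → m ≤L z → (z ≈L m) ⊎ (z ≈L v))

Comodernistic : ℕ → Set
Comodernistic n =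
  ∀ (u v : L n) → u <L v →
    Σ (L n) λ m → IsCoatomIn u v m × LeftModularIn u v m

module Submission where

-- A set of naturals is an arithmetic progression exactly when, between its least and greatest
-- elements, it contains y + z − x whenever it contains x, y and z. This closure property is
-- decidable and survives arbitrary intersections, so meets in L_n are intersections and the join of
-- two progressions is the intersection of all progressions containing both.
--
-- Let u < v and let b and e be the least and greatest elements of v. If u misses one of them, say c,
-- then v − c is a coatom of [u, v]; it is left-modular because c ∈ x whenever x ≰ v − c, while y − c
-- lies below (v − c) ∧ y. Otherwise every z in [u, v] runs from b to e with some step s | e − b, and
-- z ⊆ z′ iff s′ | s. Writing the steps of v, z and u as g, c·g and d·g identifies [u, v] with the
-- divisors of d in reverse order. For a prime p | d the progression of step p·g is a coatom, and it
-- is left-modular because for c | d with p ∤ c also c·p | d, and a divisor of c·p not divisible by p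
-- divides c.

open import Defs
open import Data.Empty using (⊥-elim)
open import Data.Fin using (Fin; toℕ; fromℕ<)
import Data.Fin as Fin
open import Data.Fin.Properties using (toℕ<n; toℕ-fromℕ<; toℕ-injective)
open import Data.Fin.Subset using (Subset; _∈_; _∉_; _⊆_; _∩_; _-_; ⁅_⁆)
open import Data.Fin.Subset.Properties
  using ( _∈?_; _⊆?_; ⊆-refl; ⊆-reflexive; ⊆-trans; ⊆-antisym; p∩q⊆p; p∩q⊆q; x∈p∩q⁺; p─q⊆p
        ; x∈p∧x≢y⇒x∈p-y; anySubset?; nonempty?)
open import Data.Nat
open import Data.Nat.Properties
open import Data.Nat.DivMod using (_/_; _%_; m≡m%n+[m/n]*n; m%n<n; m%n≤m; m/n*n≤m)
open import Data.Nat.Divisibility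
open import Data.Nat.Coprimality using (Coprime; coprime-divisor)
import Data.Nat.Coprimality as Coprimality
open import Data.Nat.Primality using (Prime; prime⇒irreducible; ¬prime[1])
open import Data.Nat.Primality.Factorisation using (factorise)
open import Data.List using ([]; _∷_)
open import Data.Nat.ListAction using (product)
open import Data.List.Relation.Unary.All using (_∷_)
open import Data.Nat.Solver using (module +-*-Solver)
open import Data.Product using (Σ; ∃; ∃-syntax; _×_; _,_; proj₁; proj₂; swap)
open import Data.Sum using (_⊎_; inj₁; inj₂; [_,_]′)
open import Data.Vec using (tabulate; _∷_; there)
open import Data.Vec.Properties using (lookup⇒[]=; []=⇒lookup; lookup∘tabulate)
open import Function using (_∘_)
open import Function.Bundles using (_⇔_; mk⇔; Equivalence)
open import Level using (Level)
open import Algebra.Properties.CommutativeSemigroup +-commutativeSemigroup using (interchange)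
open import Relation.Binary.PropositionalEquality
  using (_≡_; _≢_; refl; sym; trans; cong; cong₂; subst; module ≡-Reasoning)
open import Relation.Nullary using (¬_; ¬?; Dec; yes; no; does; contradiction)
open import Relation.Nullary.Decidable using (_→-dec_; _×-dec_; map′; decidable-stable; dec-true)
open import Relation.Unary using (Pred; Decidable; _≐_)

open +-*-Solver using (solve; _:+_; _:=_)

private
  variable
    ℓ : Level
    n w : ℕ

infix 4 _∈ℕ_

_∈ℕ_ : ℕ → Subset n → Set
w ∈ℕ S = ∃[ x ] toℕ x ≡ w × x ∈ S

module _ {S : Subset n} where

  ∈ℕ⇒< : w ∈ℕ S → w < n
  ∈ℕ⇒< (x , refl , _) = toℕ<n x

  ∈⇒∈ℕ : ∀ {x} → x ∈ S → toℕ x ∈ℕ S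
  ∈⇒∈ℕ x∈S = _ , refl , x∈S

  ∈ℕ⇒∈ : ∀ {x} → toℕ x ≡ w → w ∈ℕ S → x ∈ S
  ∈ℕ⇒∈ refl (y , eq , y∈S) = subst (_∈ S) (toℕ-injective eq) y∈S

_∈ℕ?_ : ∀ w (S : Subset n) → Dec (w ∈ℕ S)
_∈ℕ?_ {n} w S with w <? n
... | no w≮n = no (w≮n ∘ ∈ℕ⇒<)
... | yes w<n =
  map′ (λ x∈S → _ , toℕ-fromℕ< w<n , x∈S) (∈ℕ⇒∈ (toℕ-fromℕ< w<n)) (fromℕ< w<n ∈? S)

⊆⇒⊆ℕ : ∀ {S T : Subset n} → S ⊆ T → w ∈ℕ S → w ∈ℕ T
⊆⇒⊆ℕ S⊆T (x , eq , x∈S) = x , eq , S⊆T x∈S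

⊆ℕ⇒⊆ : ∀ {S T : Subset n} → (∀ {w} → w ∈ℕ S → w ∈ℕ T) → S ⊆ T
⊆ℕ⇒⊆ S⊆T x∈S = ∈ℕ⇒∈ refl (S⊆T (∈⇒∈ℕ x∈S))

∈ℕ-∩⁺ : ∀ {S T : Subset n} → w ∈ℕ S → w ∈ℕ T → w ∈ℕ S ∩ T
∈ℕ-∩⁺ (x , eq , x∈S) w∈T = x , eq , x∈p∩q⁺ (x∈S , ∈ℕ⇒∈ eq w∈T)

subset : {P : Pred (Fin n) ℓ} → Decidable P → Subset n
subset P? = tabulate (does ∘ P?)

module _ {P : Pred (Fin n) ℓ} (P? : Decidable P) {x : Fin n} where

  ∈-subset⁺ : P x → x ∈ subset P?
  ∈-subset⁺ Px = lookup⇒[]= x _ (trans (lookup∘tabulate _ x) (dec-true (P? x) Px))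

  ∈-subset⁻ : x ∈ subset P? → P x
  ∈-subset⁻ x∈ with P? x | trans (sym (lookup∘tabulate (does ∘ P?) x)) ([]=⇒lookup x∈)
  ... | yes Px | _ = Px
  ... | no _   | ()

module _ {Q : Pred ℕ ℓ} (Q? : Decidable Q) where

  ∈ℕ-subset⁺ : w < n → Q w → w ∈ℕ subset {n = n} (Q? ∘ toℕ)
  ∈ℕ-subset⁺ w<n Qw =
    fromℕ< w<n , toℕ-fromℕ< w<n , ∈-subset⁺ (Q? ∘ toℕ) (subst Q (sym (toℕ-fromℕ< w<n)) Qw)

  ∈ℕ-subset⁻ : w ∈ℕ subset {n = n} (Q? ∘ toℕ) → Q w
  ∈ℕ-subset⁻ (x , refl , x∈) = ∈-subset⁻ (Q? ∘ toℕ) x∈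

module _ {P : Pred ℕ ℓ} (P? : Decidable P) where

  private
    leastBelow : ∀ v → ∃[ w ] w < v × P w → ∃[ b ] P b × (∀ {w} → P w → b ≤ w)
    leastBelow (suc v) (w , w<1+v , Pw) with anyUpTo? P? v
    ... | yes below = leastBelow v below
    ... | no none   = w , Pw , λ Pw′ →
      ≤-trans (≤-pred w<1+v) (≮⇒≥ (λ w′<v → none (_ , w′<v , Pw′)))

    greatestBelow : ∀ v → ∃[ w ] w < v × P w →
                    ∃[ e ] P e × (∀ {w} → w < v → P w → w ≤ e)
    greatestBelow (suc v) (w , w<1+v , Pw) with P? v
    ... | yes Pv = v , Pv , λ w′<1+v _ → ≤-pred w′<1+v
    ... | no ¬Pv with greatestBelow v (w , ≤∧≢⇒< (≤-pred w<1+v) (λ { refl → ¬Pv Pw }) , Pw)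
    ...   | e , Pe , max = e , Pe , λ w′<1+v Pw′ →
      max (≤∧≢⇒< (≤-pred w′<1+v) (λ { refl → ¬Pv Pw′ })) Pw′

  least : ∀ {w} → P w → ∃[ b ] P b × (∀ {w} → P w → b ≤ w)
  least {w} Pw = leastBelow (suc w) (w , ≤-refl , Pw)

  greatest : ∀ {n w} → (∀ {w} → P w → w < n) → P w → ∃[ e ] P e × (∀ {w} → P w → w ≤ e)
  greatest {n} {w} bounded Pw with greatestBelow n (w , bounded Pw , Pw)
  ... | e , Pe , max = e , Pe , λ Pw′ → max (bounded Pw′) Pw′

Progression : ℕ → ℕ → ℕ → Pred ℕ Level.zero
Progression b e g w = b ≤ w × w ≤ e × g ∣ w ∸ b

progression? : ∀ b e g → Decidable (Progression b e g)
progression? b e g w = b ≤? w ×-dec w ≤? e ×-dec g ∣? w ∸ b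

ParallelogramClosed : Pred ℕ ℓ → Set ℓ
ParallelogramClosed P = ∀ {x y z t l h} → P x → P y → P z → P l → P h →
                        l ≤ t → t ≤ h → x + t ≡ y + z → P t

≐-closed : {P Q : Pred ℕ ℓ} → P ≐ Q → ParallelogramClosed P → ParallelogramClosed Q
≐-closed (P⊆Q , Q⊆P) closed Qx Qy Qz Ql Qh l≤t t≤h eq =
  P⊆Q (closed (Q⊆P Qx) (Q⊆P Qy) (Q⊆P Qz) (Q⊆P Ql) (Q⊆P Qh) l≤t t≤h eq)

≐-trans : {P Q R : Pred ℕ ℓ} → P ≐ Q → Q ≐ R → P ≐ R
≐-trans (P⊆Q , Q⊆P) (Q⊆R , R⊆Q) = (Q⊆R ∘ P⊆Q) , (Q⊆P ∘ R⊆Q)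

∸-parallelogram : ∀ {b x y z t} → b ≤ x → b ≤ y → b ≤ z → b ≤ t → x + t ≡ y + z →
                  (x ∸ b) + (t ∸ b) ≡ (y ∸ b) + (z ∸ b)
∸-parallelogram {b} {x} {y} {z} {t} b≤x b≤y b≤z b≤t eq = +-cancelʳ-≡ (b + b) _ _ (begin
  (x ∸ b) + (t ∸ b) + (b + b)   ≡⟨ interchange (x ∸ b) (t ∸ b) b b ⟩
  (x ∸ b + b) + (t ∸ b + b)     ≡⟨ cong₂ _+_ (m∸n+n≡m b≤x) (m∸n+n≡m b≤t) ⟩
  x + t                         ≡⟨ eq ⟩
  y + z                         ≡⟨ cong₂ _+_ (m∸n+n≡m b≤y) (m∸n+n≡m b≤z) ⟨
  (y ∸ b + b) + (z ∸ b + b)     ≡⟨ interchange (y ∸ b) (z ∸ b) b b ⟨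
  (y ∸ b) + (z ∸ b) + (b + b)   ∎)
  where open ≡-Reasoning

progression-closed : ∀ {b e g} → ParallelogramClosed (Progression b e g)
progression-closed {b} {g = g} {t = t}
  (b≤x , _ , g∣x) (b≤y , _ , g∣y) (b≤z , _ , g∣z) (b≤l , _ , _) (_ , h≤e , _) l≤t t≤h eq =
  b≤t , ≤-trans t≤h h≤e ,
  ∣m+n∣m⇒∣n (subst (g ∣_) (sym (∸-parallelogram b≤x b≤y b≤z b≤t eq)) (∣m∣n⇒∣m+n g∣y g∣z))
            g∣x
  where
  b≤t : b ≤ t
  b≤t = ≤-trans b≤l l≤t

module _ {P : Pred ℕ ℓ} (P? : Decidable P) (closed : ParallelogramClosed P)
         {b e} (Pb : P b) (Pe : P e) (extent : ∀ {w} → P w → b ≤ w × w ≤ e) where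

  -- g is the distance from b to the next element. Closure puts every b + q·g ≤ e into P, and
  -- b + (s mod g) into P whenever b + s is in P; minimality of g then forces s mod g = 0.
  private
    module Gap (b<e : b < e) where

      next : ∃[ c ] (b < c × P c) × (∀ {w} → b < w × P w → c ≤ w)
      next = least (λ w → b <? w ×-dec P? w) (b<e , Pe)

      g : ℕ
      g = proj₁ next ∸ b

      b+g≡next : b + g ≡ proj₁ next
      b+g≡next = m+[n∸m]≡n (<⇒≤ (proj₁ (proj₁ (proj₂ next))))

      g>0 : 0 < g
      g>0 = m<n⇒0<n∸m (proj₁ (proj₁ (proj₂ next)))

      instance
        g≢0 : NonZero g
        g≢0 = >-nonZero g>0

      gap-empty : ∀ {s} → 0 < s → s < g → ¬ P (b + s)
      gap-empty {s} s>0 s<g Pb+s = <⇒≱ s<g (+-cancelˡ-≤ b g s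
        (subst (_≤ b + s) (sym b+g≡next) (proj₂ (proj₂ next) (m<m+n b s>0 , Pb+s))))

      multiple : ∀ q → b + q * g ≤ e → P (b + q * g)
      multiple zero    _   = subst P (sym (+-identityʳ b)) Pb
      multiple (suc q) b+[1+q]g≤e = closed Pb (subst P (sym b+g≡next) (proj₂ (proj₁ (proj₂ next))))
        (multiple q (≤-trans (+-monoʳ-≤ b (m≤n+m (q * g) g)) b+[1+q]g≤e)) Pb Pe
        (m≤m+n b _) b+[1+q]g≤e
        (solve 3 (λ b g qg → b :+ (b :+ (g :+ qg)) := (b :+ g) :+ (b :+ qg)) refl b g (q * g))

      member⇒∣ : ∀ {w} → P w → g ∣ w ∸ b
      member⇒∣ {w} Pw = m%n≡0⇒n∣m s g (remainder≡0 (s % g) (m%n<n s g) Pb+ρ)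
        where
        b≤w : b ≤ w
        b≤w = proj₁ (extent Pw)
        s : ℕ
        s = w ∸ b
        b+s≡w : b + s ≡ w
        b+s≡w = m+[n∸m]≡n b≤w
        q : ℕ
        q = s / g
        Pb+qg : P (b + q * g)
        Pb+qg = multiple q (≤-trans (+-monoʳ-≤ b (m/n*n≤m s g)) (subst (_≤ _) (sym b+s≡w) (proj₂ (extent Pw))))
        Pb+ρ : P (b + s % g)
        Pb+ρ = closed Pb+qg Pb Pw Pb Pw (m≤m+n b _)
          (subst (b + s % g ≤_) b+s≡w (+-monoʳ-≤ b (m%n≤m s g)))
          (begin
            b + q * g + (b + s % g)
              ≡⟨ solve 3 (λ b qg ρ → b :+ qg :+ (b :+ ρ) := b :+ (b :+ (ρ :+ qg))) refl b (q * g) (s % g) ⟩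
            b + (b + (s % g + q * g))      ≡⟨ cong (λ s′ → b + (b + s′)) (m≡m%n+[m/n]*n s g) ⟨
            b + (b + s)                    ≡⟨ cong (b +_) b+s≡w ⟩
            b + w                          ∎)
          where open ≡-Reasoning
        remainder≡0 : ∀ ρ → ρ < g → P (b + ρ) → ρ ≡ 0
        remainder≡0 zero    _   _     = refl
        remainder≡0 (suc ρ) ρ<g Pb+ρ′ = contradiction Pb+ρ′ (gap-empty z<s ρ<g)

      characterisation : P ≐ Progression b e g
      characterisation = (λ Pw → proj₁ (extent Pw) , proj₂ (extent Pw) , member⇒∣ Pw) , from
        where
        from : ∀ {w} → Progression b e g w → P w
        from {w} (b≤w , w≤e , divides q w∸b≡qg) =
          subst P b+qg≡w (multiple q (subst (_≤ e) (sym b+qg≡w) w≤e))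
          where
          b+qg≡w : b + q * g ≡ w
          b+qg≡w = trans (cong (b +_) (sym w∸b≡qg)) (m+[n∸m]≡n b≤w)

  closed⇒progression : ∃[ g ] 0 < g × g ∣ e ∸ b × P ≐ Progression b e g
  closed⇒progression with m≤n⇒m<n∨m≡n (proj₁ (extent Pe))
  ... | inj₁ b<e = g , g>0 , proj₂ (proj₂ (proj₁ characterisation Pe)) , characterisation
    where open Gap b<e
  ... | inj₂ refl = 1 , z<s , 1∣ _ ,
    (λ Pw → proj₁ (extent Pw) , proj₂ (extent Pw) , 1∣ _) ,
    (λ (b≤w , w≤b , _) → subst P (≤-antisym b≤w w≤b) Pb)

-- The description of membership in IsAP, shifted by one since x : Fin n stands for toℕ x + 1.
Indexed : ℕ → ℕ → ℕ → Pred ℕ Level.zero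
Indexed a r k w = ∃[ i ] i < k × suc w ≡ a + i * r

progression≐indexed : ∀ {b q r} → 0 < r → Progression b (b + q * r) r ≐ Indexed (suc b) r (suc q)
progression≐indexed {b} {q} {r} r>0 = to , from
  where
  instance
    r≢0 : NonZero r
    r≢0 = >-nonZero r>0
  to : ∀ {w} → Progression b (b + q * r) r w → Indexed (suc b) r (suc q) w
  to {w} (b≤w , w≤e , divides i w∸b≡ir) =
    i , s≤s (*-cancelʳ-≤ i q r (+-cancelˡ-≤ b _ _ (subst (_≤ b + q * r) w≡b+ir w≤e))) , cong suc w≡b+ir
    where
    w≡b+ir : w ≡ b + i * r
    w≡b+ir = trans (sym (m+[n∸m]≡n b≤w)) (cong (b +_) w∸b≡ir)
  from : ∀ {w} → Indexed (suc b) r (suc q) w → Progression b (b + q * r) r w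
  from (i , s≤s i≤q , refl) =
    m≤m+n b (i * r) , +-monoʳ-≤ b (*-monoˡ-≤ r i≤q) , divides i (m+n∸m≡n b (i * r))

indexed-closed : ∀ {a r k} → 1 ≤ a → 0 < r → ParallelogramClosed (Indexed a r k)
indexed-closed {k = zero}  _       _   (_ , () , _)
indexed-closed {k = suc q} (s≤s _) r>0 = ≐-closed (progression≐indexed r>0) progression-closed

Closed : Subset n → Set
Closed S = ParallelogramClosed (_∈ℕ S)

module _ {S : Subset n} {a r k : ℕ} where

  indexed-elements : (∀ i → i < k → a + i * r ≤ n) →
                     (∀ x → x ∈ S ⇔ Indexed a r k (toℕ x)) → (_∈ℕ S) ≐ Indexed a r k
  indexed-elements bound iff = (λ { (x , refl , x∈S) → Equivalence.to (iff x) x∈S }) , from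
    where
    from : ∀ {w} → Indexed a r k w → w ∈ℕ S
    from {w} idx@(i , i<k , 1+w≡a+ir) = fromℕ< w<n , toℕ-fromℕ< w<n ,
      Equivalence.from (iff _) (subst (Indexed a r k) (sym (toℕ-fromℕ< w<n)) idx)
      where
      w<n : w < n
      w<n = subst (_≤ n) (sym 1+w≡a+ir) (bound i i<k)

  indexed⇒IsAP : 1 ≤ a → 0 < r → (_∈ℕ S) ≐ Indexed a r k → IsAP n S
  indexed⇒IsAP 1≤a@(s≤s {n = b} _) r>0 (S⊆I , I⊆S) = a , r , k , 1≤a , r>0 ,
    (λ i i<k → ∈ℕ⇒< (I⊆S (i , i<k , refl {x = suc b + i * r}))) ,
    λ x → mk⇔ (S⊆I ∘ ∈⇒∈ℕ) (∈ℕ⇒∈ refl ∘ I⊆S)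

IsAP⇒closed : ∀ {S : Subset n} → IsAP n S → Closed S
IsAP⇒closed (a , r , k , 1≤a , r>0 , bound , iff) =
  ≐-closed (swap (indexed-elements bound iff)) (indexed-closed 1≤a r>0)

progression⇒IsAP : ∀ {S : Subset n} {b e g} → 0 < g → g ∣ e ∸ b → e ∈ℕ S →
                   (_∈ℕ S) ≐ Progression b e g → IsAP n S
progression⇒IsAP {S = S} {b} {e} {g} g>0 (divides q e∸b≡qg) e∈S elements = indexed⇒IsAP (s≤s z≤n) g>0
  (≐-trans (subst (λ e′ → (_∈ℕ S) ≐ Progression b e′ g) e≡b+qg elements)
           (progression≐indexed {b} {q} g>0))
  where
  e≡b+qg : e ≡ b + q * g
  e≡b+qg = trans (sym (m+[n∸m]≡n (proj₁ (proj₁ elements e∈S)))) (cong (b +_) e∸b≡qg)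

extremes : ∀ {S : Subset n} → w ∈ℕ S →
           ∃[ b ] ∃[ e ] b ∈ℕ S × e ∈ℕ S × (∀ {w} → w ∈ℕ S → b ≤ w × w ≤ e)
extremes {S = S} w∈S with least (_∈ℕ? S) w∈S | greatest (_∈ℕ? S) ∈ℕ⇒< w∈S
... | b , b∈S , min | e , e∈S , max = b , e , b∈S , e∈S , λ w∈S → min w∈S , max w∈S

closed⇒IsAP : ∀ {S : Subset n} → Closed S → IsAP n S
closed⇒IsAP {S = S} closed with nonempty? S
... | no empty = 1 , 1 , 0 , s≤s z≤n , s≤s z≤n , (λ _ ()) ,
  λ x → mk⇔ (λ x∈S → contradiction (x , x∈S) empty) λ { (_ , () , _) }
... | yes (x , x∈S) with extremes (∈⇒∈ℕ x∈S)
...   | b , e , b∈S , e∈S , extent with closed⇒progression (_∈ℕ? S) closed b∈S e∈S extent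
...     | g , g>0 , g∣e∸b , elements = progression⇒IsAP g>0 g∣e∸b e∈S elements

closed? : (S : Subset n) → Dec (Closed S)
closed? {n} S = map′ unbounded (λ closed _ _ _ _ _ _ → closed)
  (allUpTo? (λ x → allUpTo? (λ y → allUpTo? (λ z → allUpTo? (λ t → allUpTo? (λ l → allUpTo? (λ h →
    x ∈ℕ? S →-dec y ∈ℕ? S →-dec z ∈ℕ? S →-dec l ∈ℕ? S →-dec h ∈ℕ? S →-dec
    l ≤? t →-dec t ≤? h →-dec x + t ≟ y + z →-dec t ∈ℕ? S) n) n) n) n) n) n)
  where
  ClosedBelow : Set
  ClosedBelow = ∀ {x} → x < n → ∀ {y} → y < n → ∀ {z} → z < n →
                ∀ {t} → t < n → ∀ {l} → l < n → ∀ {h} → h < n →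
                x ∈ℕ S → y ∈ℕ S → z ∈ℕ S → l ∈ℕ S → h ∈ℕ S →
                l ≤ t → t ≤ h → x + t ≡ y + z → t ∈ℕ S
  unbounded : ClosedBelow → Closed S
  unbounded closed x∈ y∈ z∈ l∈ h∈ l≤t t≤h =
    closed (∈ℕ⇒< x∈) (∈ℕ⇒< y∈) (∈ℕ⇒< z∈) (≤-<-trans t≤h (∈ℕ⇒< h∈)) (∈ℕ⇒< l∈) (∈ℕ⇒< h∈)
           x∈ y∈ z∈ l∈ h∈ l≤t t≤h

allSubset? : {P : Pred (Subset n) ℓ} → Decidable P → Dec (∀ S → P S)
allSubset? P? with anySubset? (¬? ∘ P?)
... | yes (S , ¬PS) = no λ all → ¬PS (all S)
... | no none       = yes λ S → decidable-stable (P? S) λ ¬PS → none (S , ¬PS)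

∩-closed : ∀ {S T : Subset n} → Closed S → Closed T → Closed (S ∩ T)
∩-closed {S = S} {T} S-closed T-closed x∈ y∈ z∈ l∈ h∈ l≤t t≤h eq = ∈ℕ-∩⁺
  (S-closed (inS x∈) (inS y∈) (inS z∈) (inS l∈) (inS h∈) l≤t t≤h eq)
  (T-closed (inT x∈) (inT y∈) (inT z∈) (inT l∈) (inT h∈) l≤t t≤h eq)
  where
  inS : ∀ {w} → w ∈ℕ S ∩ T → w ∈ℕ S
  inS = ⊆⇒⊆ℕ (p∩q⊆p S T)
  inT : ∀ {w} → w ∈ℕ S ∩ T → w ∈ℕ T
  inT = ⊆⇒⊆ℕ (p∩q⊆q S T)

meet : (x y : L n) → Σ (L n) λ m → (m ≤L x) × (m ≤L y) × (∀ z → z ≤L x → z ≤L y → z ≤L m)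
meet (X , X-AP) (Y , Y-AP) = (X ∩ Y , closed⇒IsAP (∩-closed (IsAP⇒closed X-AP) (IsAP⇒closed Y-AP))) ,
  p∩q⊆p X Y , p∩q⊆q X Y , λ _ z⊆X z⊆Y w∈z → x∈p∩q⁺ (z⊆X w∈z , z⊆Y w∈z)

join : (x y : L n) → Σ (L n) λ j → (x ≤L j) × (y ≤L j) × (∀ z → x ≤L z → y ≤L z → j ≤L z)
join {n} (X , _) (Y , _) = (J , closed⇒IsAP J-closed) ,
  (λ w∈X → ∈-subset⁺ (upper? ∘ toℕ) λ T _ X⊆T _ → ∈⇒∈ℕ (X⊆T w∈X)) ,
  (λ w∈Y → ∈-subset⁺ (upper? ∘ toℕ) λ T _ _ Y⊆T → ∈⇒∈ℕ (Y⊆T w∈Y)) ,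
  λ (Z , Z-AP) X⊆Z Y⊆Z w∈J →
    ∈ℕ⇒∈ refl (∈-subset⁻ (upper? ∘ toℕ) w∈J Z (IsAP⇒closed Z-AP) X⊆Z Y⊆Z)
  where
  Upper : Pred ℕ Level.zero
  Upper w = ∀ T → Closed T → X ⊆ T → Y ⊆ T → w ∈ℕ T
  upper? : Decidable Upper
  upper? w = allSubset? λ T → closed? T →-dec X ⊆? T →-dec Y ⊆? T →-dec w ∈ℕ? T
  J : Subset n
  J = subset (upper? ∘ toℕ)
  J-closed : Closed J
  J-closed x∈ y∈ z∈ l∈ h∈ l≤t t≤h eq = ∈ℕ-subset⁺ upper? (≤-<-trans t≤h (∈ℕ⇒< h∈))
    λ T T-closed X⊆T Y⊆T → let inT = λ {w} (w∈J : w ∈ℕ J) → ∈ℕ-subset⁻ upper? w∈J T T-closed X⊆T Y⊆T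
                           in T-closed (inT x∈) (inT y∈) (inT z∈) (inT l∈) (inT h∈) l≤t t≤h eq

isLattice : ∀ n → IsLatticeL n
isLattice n x y = join x y , meet x y

LeftModularCoatom : L n → L n → Set
LeftModularCoatom {n} u v = Σ (L n) λ m → IsCoatomIn u v m × LeftModularIn u v m

-- Since (x ∨ m) ∧ y ≥ x ∨ (m ∧ y) always holds, only the reverse inclusion needs an argument, and
-- for x ≤ m it is automatic.
leftModularIn-criterion : ∀ {u v m : L n} → In u v m →
  (∀ x y l p → In u v x → In u v y → x ≤L y → ¬ x ≤L m →
     IsMeetIn u v m y l → IsJoinIn u v x l p → y ≤L p) →
  LeftModularIn u v m
leftModularIn-criterion {m = m} m∈ absorbs x y x∈ y∈ (x≤y , _) j k l p
  (j∈ , x≤j , m≤j , j-least) (k∈ , k≤j , k≤y , k-greatest) l-meet@(l∈ , l≤m , l≤y , l-greatest)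
  p-join@(p∈ , x≤p , l≤p , p-least) = ⊆-antisym k≤p p≤k
  where
  p≤k : p ≤L k
  p≤k = k-greatest p p∈ (p-least j j∈ x≤j (⊆-trans l≤m m≤j)) (p-least y y∈ x≤y l≤y)
  k≤p : k ≤L p
  k≤p with proj₁ x ⊆? proj₁ m
  ... | yes x≤m = ⊆-trans (l-greatest k k∈ (⊆-trans k≤j (j-least m m∈ x≤m ⊆-refl)) k≤y) l≤p
  ... | no x≰m  = ⊆-trans k≤y (absorbs x y l p x∈ y∈ x≤y x≰m l-meet p-join)

x∉p-x : ∀ (p : Subset n) x → x ∉ p - x
x∉p-x (_ ∷ p) (Fin.suc x) (there x∈p-x) = x∉p-x p x x∈p-x

p-x⊆p : ∀ {p : Subset n} {x} → p - x ⊆ p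
p-x⊆p {p = p} {x} = p─q⊆p p ⁅ x ⁆

⊆-x : ∀ {p q : Subset n} {x} → p ⊆ q → x ∉ p → p ⊆ q - x
⊆-x p⊆q x∉p {y} y∈p = x∈p∧x≢y⇒x∈p-y (p⊆q y∈p) λ { refl → x∉p y∈p }

-x⊆⇒⊆ : ∀ {p q : Subset n} {x} → p - x ⊆ q → x ∈ q → p ⊆ q
-x⊆⇒⊆ {x = x} p-x⊆q x∈q {y} y∈p with y Fin.≟ x
... | yes refl = x∈q
... | no y≢x   = p-x⊆q (x∈p∧x≢y⇒x∈p-y y∈p y≢x)

removal-leftModularCoatom : ∀ {u v : L n} c → u ≤L v → c ∈ proj₁ v → c ∉ proj₁ u →
  (∀ (y : L n) → y ≤L v → IsAP n (proj₁ y - c)) → LeftModularCoatom u v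
removal-leftModularCoatom {n} {u} {v} c u≤v c∈v c∉u remove =
  m , (m∈ , (proj₂ m∈ , m≢v) , covered) , leftModularIn-criterion {u = u} {v} {m} m∈ absorbs
  where
  without-c : (y : L n) → y ≤L v → L n
  without-c y y≤v = proj₁ y - c , remove y y≤v
  m : L n
  m = without-c v ⊆-refl
  m∈ : In u v m
  m∈ = ⊆-x u≤v c∉u , p-x⊆p
  m≢v : ¬ m ≈L v
  m≢v m≡v = x∉p-x (proj₁ v) c (subst (c ∈_) (sym m≡v) c∈v)
  covered : ∀ z → In u v z → m ≤L z → (z ≈L m) ⊎ (z ≈L v)
  covered z (_ , z≤v) m≤z with c ∈? proj₁ z
  ... | yes c∈z = inj₂ (⊆-antisym z≤v (-x⊆⇒⊆ m≤z c∈z))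
  ... | no c∉z  = inj₁ (⊆-antisym (⊆-x z≤v c∉z) m≤z)
  absorbs : ∀ x y l p → In u v x → In u v y → x ≤L y → ¬ x ≤L m →
            IsMeetIn u v m y l → IsJoinIn u v x l p → y ≤L p
  absorbs x y l p (_ , x≤v) (u≤y , y≤v) _ x≰m (_ , _ , _ , l-greatest) (_ , x≤p , l≤p , _) =
    -x⊆⇒⊆ (⊆-trans y-c≤l l≤p) (x≤p c∈x)
    where
    c∈x : c ∈ proj₁ x
    c∈x with c ∈? proj₁ x
    ... | yes c∈x = c∈x
    ... | no c∉x  = ⊥-elim (x≰m (⊆-x x≤v c∉x))
    y-c≤l : without-c y y≤v ≤L l
    y-c≤l = l-greatest (without-c y y≤v) (⊆-x u≤y c∉u , ⊆-trans p-x⊆p y≤v)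
      (⊆-x (⊆-trans p-x⊆p y≤v) (x∉p-x (proj₁ y) c)) p-x⊆p

Extremal : ℕ → Subset n → Set
Extremal c S = (∀ {w} → w ∈ℕ S → w ≤ c) ⊎ (∀ {w} → w ∈ℕ S → c ≤ w)

extremal-⊆ : ∀ {S T : Subset n} {c} → S ⊆ T → Extremal c T → Extremal c S
extremal-⊆ S⊆T (inj₁ max) = inj₁ λ w∈S → max (⊆⇒⊆ℕ S⊆T w∈S)
extremal-⊆ S⊆T (inj₂ min) = inj₂ λ w∈S → min (⊆⇒⊆ℕ S⊆T w∈S)

-extremal-closed : ∀ {S : Subset n} {c} → Closed S → Extremal (toℕ c) S → Closed (S - c)
-extremal-closed {S = S} {c} closed extremal {t = t} x∈ y∈ z∈ l∈ h∈ l≤t t≤h eq =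
  let f , f≡t , f∈S = closed (inS x∈) (inS y∈) (inS z∈) (inS l∈) (inS h∈) l≤t t≤h eq
  in f , f≡t , x∈p∧x≢y⇒x∈p-y f∈S λ f≡c → t≢c (trans (sym f≡t) (cong toℕ f≡c))
  where
  inS : ∀ {w} → w ∈ℕ S - c → w ∈ℕ S
  inS = ⊆⇒⊆ℕ p-x⊆p
  ≢c : ∀ {w} → w ∈ℕ S - c → w ≢ toℕ c
  ≢c (x , refl , x∈S-c) x≡c = x∉p-x S c (subst (_∈ S - c) (toℕ-injective x≡c) x∈S-c)
  t≢c : t ≢ toℕ c
  t≢c t≡c = [ (λ max → ≢c h∈ (≤-antisym (max (inS h∈)) (subst (_≤ _) t≡c t≤h)))
            , (λ min → ≢c l∈ (≤-antisym (subst (_ ≤_) t≡c l≤t) (min (inS l∈)))) ]′ extremal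

endpoint-removal : ∀ {u v : L n} {w} → u ≤L v → w ∈ℕ proj₁ v → ¬ w ∈ℕ proj₁ u →
                   Extremal w (proj₁ v) → LeftModularCoatom u v
endpoint-removal {u = u} {v} u≤v (c , refl , c∈v) c∉u extremal =
  removal-leftModularCoatom {u = u} {v} c u≤v c∈v (c∉u ∘ ∈⇒∈ℕ) λ y y≤v →
    closed⇒IsAP (-extremal-closed (IsAP⇒closed (proj₂ y)) (extremal-⊆ y≤v extremal))

prime∤⇒coprime : ∀ {p m} → Prime p → ¬ p ∣ m → Coprime m p
prime∤⇒coprime p-prime p∤m (d∣m , d∣p) with prime⇒irreducible p-prime d∣p
... | inj₁ d≡1 = d≡1
... | inj₂ refl = contradiction d∣m p∤m

coprime⇒*∣ : ∀ {m k d} → Coprime m k → m ∣ d → k ∣ d → m * k ∣ d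
coprime⇒*∣ {m} {k} coprime (divides q refl) k∣qm
  with coprime-divisor (Coprimality.sym coprime) (subst (k ∣_) (*-comm q m) k∣qm)
... | divides q′ refl = divides q′ (trans (*-assoc q′ k m) (cong (q′ *_) (*-comm k m)))

∃-prime-divisor : ∀ {d} → 1 < d → ∃[ p ] Prime p × p ∣ d
∃-prime-divisor {d} 1<d with factorise d {{>-nonZero (<-trans z<s 1<d)}}
... | record { factors = [] ; isFactorisation = d≡1 } = contradiction d≡1 (>⇒≢ 1<d)
... | record { factors = p ∷ ps ; isFactorisation = d≡p*ps ; factorsPrime = p-prime ∷ _ } =
  p , p-prime , subst (p ∣_) (sym d≡p*ps) (m∣m*n (product ps))

module Divisors {n} {u v : L n} (u≤v : u ≤L v) (u≢v : ¬ u ≈L v) {b e : ℕ}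
                (b∈u : b ∈ℕ proj₁ u) (e∈u : e ∈ℕ proj₁ u) (b<e : b < e)
                (v-extent : ∀ {w} → w ∈ℕ proj₁ v → b ≤ w × w ≤ e) where

  record Step (z : L n) (s : ℕ) : Set where
    constructor step
    field
      step∣e∸b : s ∣ e ∸ b
      elements : (_∈ℕ proj₁ z) ≐ Progression b e s

  step-positive : ∀ {z s} → Step z s → 0 < s
  step-positive {s = zero}  (step 0∣e∸b _) = contradiction (0∣⇒≡0 0∣e∸b) (>⇒≢ (m<n⇒0<n∸m b<e))
  step-positive {s = suc _} _              = z<s

  step-of : ∀ {z} → In u v z → ∃ (Step z)
  step-of {z} (u≤z , z≤v) with closed⇒progression (_∈ℕ? proj₁ z) (IsAP⇒closed (proj₂ z))
    (⊆⇒⊆ℕ u≤z b∈u) (⊆⇒⊆ℕ u≤z e∈u) (λ w∈z → v-extent (⊆⇒⊆ℕ z≤v w∈z))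
  ... | s , _ , s∣e∸b , elements = s , step s∣e∸b elements

  step-realised : ∀ {s} → s ∣ e ∸ b → Σ (L n) λ z → Step z s
  step-realised {s} s∣e∸b =
    (S , closed⇒IsAP (≐-closed (swap elements) progression-closed)) , step s∣e∸b elements
    where
    S : Subset n
    S = subset (progression? b e s ∘ toℕ)
    elements : (_∈ℕ S) ≐ Progression b e s
    elements = ∈ℕ-subset⁻ (progression? b e s) ,
      λ w∈P → ∈ℕ-subset⁺ (progression? b e s) (≤-<-trans (proj₁ (proj₂ w∈P)) (∈ℕ⇒< e∈u)) w∈P

  step∣⇒⊆ : ∀ {z₁ z₂ s₁ s₂} → Step z₁ s₁ → Step z₂ s₂ → s₂ ∣ s₁ → z₁ ≤L z₂
  step∣⇒⊆ (step _ (z₁⊆P , _)) (step _ (_ , P⊆z₂)) s₂∣s₁ = ⊆ℕ⇒⊆ λ w∈z₁ →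
    let b≤w , w≤e , s₁∣w∸b = z₁⊆P w∈z₁ in P⊆z₂ (b≤w , w≤e , ∣-trans s₂∣s₁ s₁∣w∸b)

  ⊆⇒step∣ : ∀ {z₁ z₂ s₁ s₂} → Step z₁ s₁ → Step z₂ s₂ → z₁ ≤L z₂ → s₂ ∣ s₁
  ⊆⇒step∣ {s₁ = s₁} {s₂} (step s₁∣e∸b (_ , P⊆z₁)) (step _ (z₂⊆P , _)) z₁≤z₂ =
    subst (s₂ ∣_) (m+n∸m≡n b s₁) (proj₂ (proj₂ (z₂⊆P (⊆⇒⊆ℕ z₁≤z₂ (P⊆z₁ next-element)))))
    where
    next-element : Progression b e s₁ (b + s₁)
    next-element = m≤m+n b s₁ ,
      subst (b + s₁ ≤_) (m+[n∸m]≡n (<⇒≤ b<e))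
            (+-monoʳ-≤ b (∣⇒≤ {{>-nonZero (m<n⇒0<n∸m b<e)}} s₁∣e∸b)) ,
      subst (s₁ ∣_) (sym (m+n∸m≡n b s₁)) ∣-refl

  step-unique : ∀ {z₁ z₂ s} → Step z₁ s → Step z₂ s → z₁ ≈L z₂
  step-unique z₁-step z₂-step =
    ⊆-antisym (step∣⇒⊆ z₁-step z₂-step ∣-refl) (step∣⇒⊆ z₂-step z₁-step ∣-refl)

  module Indexing {g} (v-step : Step v g) where

    instance
      g≢0 : NonZero g
      g≢0 = >-nonZero (step-positive v-step)

    record Index (z : L n) (c : ℕ) : Set where
      constructor index
      field
        index-step : Step z (c * g)

    index-of : ∀ {z} → In u v z → ∃ (Index z)
    index-of z∈ with step-of z∈
    ... | s , z-step with ⊆⇒step∣ z-step v-step (proj₂ z∈)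
    ...   | divides c s≡cg = c , index (subst (Step _) s≡cg z-step)

    index-positive : ∀ {z c} → Index z c → 0 < c
    index-positive {c = zero}  (index z-step) = contradiction (step-positive z-step) (<-irrefl refl)
    index-positive {c = suc _} _              = z<s

    index∣⇒⊆ : ∀ {z₁ z₂ c₁ c₂} → Index z₁ c₁ → Index z₂ c₂ → c₂ ∣ c₁ → z₁ ≤L z₂
    index∣⇒⊆ (index z₁-step) (index z₂-step) c₂∣c₁ =
      step∣⇒⊆ z₁-step z₂-step (*-monoˡ-∣ g c₂∣c₁)

    ⊆⇒index∣ : ∀ {z₁ z₂ c₁ c₂} → Index z₁ c₁ → Index z₂ c₂ → z₁ ≤L z₂ → c₂ ∣ c₁
    ⊆⇒index∣ (index z₁-step) (index z₂-step) z₁≤z₂ =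
      *-cancelʳ-∣ g (⊆⇒step∣ z₁-step z₂-step z₁≤z₂)

    index-unique : ∀ {z₁ z₂ c} → Index z₁ c → Index z₂ c → z₁ ≈L z₂
    index-unique (index z₁-step) (index z₂-step) = step-unique z₁-step z₂-step

    v-index : Index v 1
    v-index = index (subst (Step v) (sym (*-identityˡ g)) v-step)

    module _ {d} (u-index : Index u d) where

      1<d : 1 < d
      1<d = ≤∧≢⇒< (index-positive u-index) λ { refl → u≢v (index-unique u-index v-index) }

      index-realised : ∀ {c} → c ∣ d → Σ (L n) λ z → In u v z × Index z c
      index-realised {c} c∣d =
        let z , z-step = step-realised (∣-trans (*-monoˡ-∣ g c∣d) (Step.step∣e∸b (Index.index-step u-index)))
        in z , (index∣⇒⊆ u-index (index z-step) c∣d , index∣⇒⊆ (index z-step) v-index (1∣ c)) , index z-step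

      module PrimeCoatom {p} (p-prime : Prime p) (p∣d : p ∣ d) {m} (m∈ : In u v m) (m-index : Index m p) where

        m-coatom : IsCoatomIn u v m
        m-coatom = m∈ , (proj₂ m∈ , m≢v) , λ z z∈ m≤z → covered m≤z (proj₂ (index-of {z} z∈))
          where
          m≢v : ¬ m ≈L v
          m≢v m≡v =
            ¬prime[1] (subst Prime (∣1⇒≡1 (⊆⇒index∣ v-index m-index (⊆-reflexive (sym m≡v)))) p-prime)
          covered : ∀ {z c} → m ≤L z → Index z c → (z ≈L m) ⊎ (z ≈L v)
          covered {z} m≤z z-index = [ (λ c≡1 → inj₂ (index-unique (subst (Index z) c≡1 z-index) v-index))
                                    , (λ c≡p → inj₁ (index-unique (subst (Index z) c≡p z-index) m-index)) ]′
                                    (prime⇒irreducible p-prime (⊆⇒index∣ m-index z-index m≤z))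

        m-leftModular : LeftModularIn u v m
        m-leftModular = leftModularIn-criterion {u = u} {v} {m} m∈
          λ x y l q x∈ y∈ x≤y x≰m l-meet q-join →
            absorbs {x} {y} {l} {q} y∈ x≰m l-meet q-join
              (proj₂ (index-of {x} x∈)) (proj₂ (index-of {y} y∈)) (proj₂ (index-of {q} (proj₁ q-join)))
          where
          absorbs : ∀ {x y l q a c c′} → In u v y → ¬ x ≤L m → IsMeetIn u v m y l → IsJoinIn u v x l q →
                    Index x a → Index y c → Index q c′ → y ≤L q
          absorbs {y = y} {l} {c = c} {c′} y∈ x≰m (_ , _ , _ , l-greatest) (_ , x≤q , l≤q , _)
                  x-index y-index q-index with p ∣? c
          ... | yes p∣c = ⊆-trans (l-greatest y y∈ (index∣⇒⊆ y-index m-index p∣c) ⊆-refl) l≤q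
          ... | no p∤c  = index∣⇒⊆ y-index q-index c′∣c
            where
            below-l : ∀ {z} → In u v z → Index z (c * p) → z ≤L l
            below-l {z} z∈ z-index =
              l-greatest z z∈ (index∣⇒⊆ z-index m-index (n∣m*n c)) (index∣⇒⊆ z-index y-index (m∣m*n p))
            c′∣c*p : c′ ∣ c * p
            c′∣c*p = let z , z∈ , z-index = index-realised
                           (coprime⇒*∣ (prime∤⇒coprime p-prime p∤c) (⊆⇒index∣ u-index y-index (proj₁ y∈)) p∣d)
                     in ⊆⇒index∣ z-index q-index (⊆-trans (below-l z∈ z-index) l≤q)
            p∤c′ : ¬ p ∣ c′
            p∤c′ p∣c′ =
              x≰m (index∣⇒⊆ x-index m-index (∣-trans p∣c′ (⊆⇒index∣ x-index q-index x≤q)))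
            c′∣c : c′ ∣ c
            c′∣c = coprime-divisor (prime∤⇒coprime p-prime p∤c′) (subst (c′ ∣_) (*-comm c p) c′∣c*p)

      indexed-leftModularCoatom : LeftModularCoatom u v
      indexed-leftModularCoatom =
        let p , p-prime , p∣d = ∃-prime-divisor 1<d
            m , m∈ , m-index = index-realised p∣d
            open PrimeCoatom p-prime p∣d m∈ m-index
        in m , m-coatom , m-leftModular

  leftModularCoatom : LeftModularCoatom u v
  leftModularCoatom =
    let g , v-step = step-of (u≤v , ⊆-refl)
        d , u-index = Indexing.index-of v-step (⊆-refl , u≤v)
    in Indexing.indexed-leftModularCoatom v-step u-index

comodernistic : ∀ n → Comodernistic n
comodernistic n u v (u≤v , u≢v) with nonempty? (proj₁ v)
... | no v-empty = ⊥-elim (u≢v (⊆-antisym u≤v λ x∈v → ⊥-elim (v-empty (_ , x∈v))))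
... | yes (x , x∈v) with extremes (∈⇒∈ℕ x∈v)
...   | b , e , b∈v , e∈v , extent with b ∈ℕ? proj₁ u | e ∈ℕ? proj₁ u
...     | no b∉u  | _       = endpoint-removal {u = u} {v} u≤v b∈v b∉u (inj₂ λ w∈v → proj₁ (extent w∈v))
...     | yes _   | no e∉u  = endpoint-removal {u = u} {v} u≤v e∈v e∉u (inj₁ λ w∈v → proj₂ (extent w∈v))
...     | yes b∈u | yes e∈u with m≤n⇒m<n∨m≡n (proj₁ (extent e∈v))
...       | inj₁ b<e  = Divisors.leftModularCoatom {u = u} {v} u≤v u≢v b∈u e∈u b<e extent
...       | inj₂ refl = ⊥-elim (u≢v (⊆-antisym u≤v (⊆ℕ⇒⊆ λ w∈v →
  subst (_∈ℕ proj₁ u) (≤-antisym (proj₁ (extent w∈v)) (proj₂ (extent w∈v))) b∈u)))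

theorem11 : ∀ (n : ℕ) → IsLatticeL n × Comodernistic n
theorem11 n = isLattice n , comodernistic n
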